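{- Let $k$ be a positive integer, let $n=8^{7^k}$, and let $a=(n-1)^{n-1}$, $b=n^n-(n-1)^{n-1}$, $c=n^n$. Then $a,b,c$ are pairwise relatively prime with $a+b=c$, and $R(abc)<\frac{6b}{7^k n}$. In particular, $R(abc)<6\log 8\,\frac{c}{\log c}$.
   Context: $R(N)$ denotes the radical of a positive integer $N$, the product of the distinct primes dividing $N$. -}

module Defs where

open import Data.Nat using (ℕ; suc)
open import Data.List using (List; filter; upTo)
open import Data.Nat.ListAction using (product)
open import Data.Nat.Divisibility using (_∣_; _∣?_)
open import Data.Nat.Primality using (Prime; prime?)
open import Relation.Nullary.Decidable using (_×-dec_)

-- The radical R(N): product of the distinct primes p dividing N
-- (primes dividing N > 0 are all ≤ N, so we range over p < N + 1).
rad : ℕ → ℕ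
rad N = product (filter (λ p → prime? p ×-dec (p ∣? N)) (upTo (suc N)))

-- Write w = n − 1. Since 8 ≡ 1 (mod 7), lifting the exponent gives 7^(k+1) ∣ w, so every
-- prime factor of a = w^w divides w / 7^k, and the only prime factor of c = n^n is 2. The
-- heart of the matter is that n = 2 + 6s forces (n² − n + 1)²/3 to divide b: modulo
-- n² − n + 1 both n⁶ and w⁶ are 1, and expanding n^n = n²(n⁶)^s and w^w = w(w⁶)^s to first
-- order in n² − n + 1 leaves a difference divisible by (n² − n + 1)²/3. Hence
-- rad(b) ≤ 3b/(n² − n + 1), and since n² − n + 1 = nw + 1 > nw the bound follows.
module Submission where

open import Defs
open import Data.Nat using (ℕ; _+_; _*_; _∸_; _^_; _≤_; _<_)
open import Data.Nat.Coprimality using (Coprime)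
open import Data.Product using (_×_)
open import Relation.Binary.PropositionalEquality using (_≡_)

open import Data.Nat using (zero; suc; z≤n; s≤s; z<s; nonTrivial⇒≢1)
open import Data.Nat.Properties
open import Data.Nat.Divisibility
open import Data.Nat.Primality using (Prime; prime?; euclidsLemma; prime⇒irreducible; prime⇒nonTrivial)
open import Data.Nat.Coprimality using (1-coprimeTo; coprime-+; coprime-divisor) renaming (sym to coprime-sym)
open import Data.Nat.ListAction using (product)
open import Data.Nat.Tactic.RingSolver using (solve-∀)
open import Data.List using (_∷_; filter; upTo)
open import Data.List.Relation.Unary.All as All using (All; []; _∷_)
open import Data.List.Relation.Unary.All.Properties using (all-filter)
open import Data.List.Relation.Unary.AllPairs using (_∷_)
open import Data.List.Relation.Unary.Unique.Propositional using (Unique)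
open import Data.List.Relation.Unary.Unique.Propositional.Properties using (filter⁺; upTo⁺)
open import Data.Product using (∃-syntax; _,_; proj₁)
open import Data.Sum using ([_,_]′)
open import Function using (id; _∘_)
open import Relation.Binary.PropositionalEquality using (_≢_; refl; sym; trans; cong; cong₂; subst; module ≡-Reasoning)
open import Relation.Nullary using (¬_; Dec; contradiction)
open import Relation.Nullary.Decidable using (_×-dec_)

prime⇒≢1 : ∀ {p} → Prime p → p ≢ 1
prime⇒≢1 pp = nonTrivial⇒≢1 {{prime⇒nonTrivial pp}}

prime∣prime⇒≡ : ∀ {p q} → Prime p → Prime q → p ∣ q → p ≡ q
prime∣prime⇒≡ pp pq p∣q = [ (λ p≡1 → contradiction p≡1 (prime⇒≢1 pp)) , id ]′ (prime⇒irreducible pq p∣q)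

prime∣^⇒∣ : ∀ {p} m e → Prime p → p ∣ m ^ e → p ∣ m
prime∣^⇒∣ m zero    pp p∣1 = contradiction (∣1⇒≡1 p∣1) (prime⇒≢1 pp)
prime∣^⇒∣ m (suc e) pp p∣  = [ id , prime∣^⇒∣ m e pp ]′ (euclidsLemma m (m ^ e) pp p∣)

prime∤product : ∀ {p qs} → Prime p → All Prime qs → All (p ≢_) qs → ¬ p ∣ product qs
prime∤product pp []          []          p∣1 = prime⇒≢1 pp (∣1⇒≡1 p∣1)
prime∤product pp (pq ∷ pqs) (p≢q ∷ p≢qs) p∣  =
  [ p≢q ∘ prime∣prime⇒≡ pp pq , prime∤product pp pqs p≢qs ]′ (euclidsLemma _ _ pp p∣)

product-∣ : ∀ {ps n} → All Prime ps → Unique ps → All (_∣ n) ps → product ps ∣ n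
product-∣ []          _            _            = 1∣ _
product-∣ {p ∷ ps} (pp ∷ pps) (p∉ps ∷ uniq) (p∣n ∷ ps∣n) with product-∣ pps uniq ps∣n
... | divides o n≡o*P = subst (p * product ps ∣_) (sym n≡o*P) (*-monoˡ-∣ (product ps) p∣o)
  where
  p∣o : p ∣ o
  p∣o = [ id , (λ p∣P → contradiction p∣P (prime∤product pp pps p∉ps)) ]′
          (euclidsLemma o (product ps) pp (subst (p ∣_) n≡o*P p∣n))

infix 4 _∣ᵣ_

-- Equivalent to rad m ∣ n.
_∣ᵣ_ : ℕ → ℕ → Set
m ∣ᵣ n = ∀ {p} → Prime p → p ∣ m → p ∣ n

∣ᵣ-refl : ∀ {m} → m ∣ᵣ m
∣ᵣ-refl _ = id

∣ᵣ-trans : ∀ {m n o} → m ∣ᵣ n → n ∣ᵣ o → m ∣ᵣ o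
∣ᵣ-trans m∣ᵣn n∣ᵣo pp = n∣ᵣo pp ∘ m∣ᵣn pp

*-pres-∣ᵣ : ∀ {m m′ n n′} → m ∣ᵣ m′ → n ∣ᵣ n′ → m * n ∣ᵣ m′ * n′
*-pres-∣ᵣ {m} {m′} {n} {n′} m∣ᵣm′ n∣ᵣn′ pp p∣ =
  [ ∣m⇒∣m*n n′ ∘ m∣ᵣm′ pp , ∣n⇒∣m*n m′ ∘ n∣ᵣn′ pp ]′ (euclidsLemma m n pp p∣)

^-∣ᵣ : ∀ m e → m ^ e ∣ᵣ m
^-∣ᵣ m e pp = prime∣^⇒∣ m e pp

m*[m*n]∣ᵣm*n : ∀ m n → m * (m * n) ∣ᵣ m * n
m*[m*n]∣ᵣm*n m n pp p∣ = [ ∣m⇒∣m*n n , id ]′ (euclidsLemma m (m * n) pp p∣)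

rad-∣ : ∀ {m n} → m ∣ᵣ n → rad m ∣ n
rad-∣ {m} m∣ᵣn = product-∣
  (All.map proj₁ prime-divisors) (filter⁺ P? (upTo⁺ (suc m)))
  (All.map (λ (pp , p∣m) → m∣ᵣn pp p∣m) prime-divisors)
  where
  P? : ∀ p → Dec (Prime p × p ∣ m)
  P? p = prime? p ×-dec (p ∣? m)
  prime-divisors : All (λ p → Prime p × p ∣ m) (filter P? (upTo (suc m)))
  prime-divisors = all-filter P? (upTo (suc m))

coprime-*ˡ : ∀ {m n o} → Coprime m o → Coprime n o → Coprime (m * n) o
coprime-*ˡ m⊥o n⊥o (d∣mn , d∣o) =
  n⊥o (coprime-divisor (λ (d∣d , d∣m) → m⊥o (d∣m , ∣-trans d∣d d∣o)) d∣mn , d∣o)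

coprime-^ˡ : ∀ {m n} e → Coprime m n → Coprime (m ^ e) n
coprime-^ˡ zero    _   (d∣1 , _) = ∣1⇒≡1 d∣1
coprime-^ˡ (suc e) m⊥n = coprime-*ˡ m⊥n (coprime-^ˡ e m⊥n)

coprime-^ : ∀ {m n} e f → Coprime m n → Coprime (m ^ e) (n ^ f)
coprime-^ e f m⊥n = coprime-^ˡ e (coprime-sym (coprime-^ˡ f (coprime-sym m⊥n)))

coprime-suc : ∀ n → Coprime n (suc n)
coprime-suc n = coprime-sym (subst (λ m → Coprime m n) (+-comm n 1) (coprime-+ (1-coprimeTo n)))

coprime-∸ʳ : ∀ {m n} → m ≤ n → Coprime m n → Coprime m (n ∸ m)
coprime-∸ʳ m≤n m⊥n (d∣m , d∣n∸m) = m⊥n (d∣m , ∣m∸n∣n⇒∣m _ m≤n d∣n∸m d∣m)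

coprime-∸ˡ : ∀ {m n} → m ≤ n → Coprime m n → Coprime (n ∸ m) n
coprime-∸ˡ m≤n m⊥n (d∣n∸m , d∣n) =
  m⊥n (∣m+n∣m⇒∣n (subst (_ ∣_) (sym (m∸n+n≡m m≤n)) d∣n) d∣n∸m , d∣n)

^-self-< : ∀ n → suc n ^ suc n < suc (suc n) ^ suc (suc n)
^-self-< n = ≤-<-trans (^-monoˡ-≤ (suc n) (n≤1+n (suc n)))
                       (^-monoʳ-< (suc (suc n)) (s≤s (s≤s z≤n)) (n<1+n (suc n)))

+*≡+*⇒∣∸ : ∀ x y {q u v} → x + q * u ≡ y + q * v → q ∣ x ∸ y
+*≡+*⇒∣∸ x y {q} {u} {v} eq = divides (v ∸ u) (begin
  x ∸ y                         ≡⟨ [m+n]∸[m+o]≡n∸o (q * u) x y ⟨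
  q * u + x ∸ (q * u + y)       ≡⟨ cong₂ _∸_ (+-comm (q * u) x) (+-comm (q * u) y) ⟩
  x + q * u ∸ (y + q * u)       ≡⟨ cong (_∸ (y + q * u)) eq ⟩
  y + q * v ∸ (y + q * u)       ≡⟨ [m+n]∸[m+o]≡n∸o y (q * v) (q * u) ⟩
  q * v ∸ q * u                 ≡⟨ *-distribˡ-∸ q v u ⟨
  q * (v ∸ u)                   ≡⟨ *-comm q (v ∸ u) ⟩
  (v ∸ u) * q                   ∎)
  where open ≡-Reasoning

[1+m*e]^s≡1+s*m*e+m*m*_ : ∀ m e s → ∃[ K ] (1 + m * e) ^ s ≡ 1 + s * (m * e) + m * m * K
[1+m*e]^s≡1+s*m*e+m*m*_ m e zero = 0 , cong (1 +_) (sym (*-zeroʳ (m * m)))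
[1+m*e]^s≡1+s*m*e+m*m*_ m e (suc s) =
  let K , eq = [1+m*e]^s≡1+s*m*e+m*m*_ m e s
  in s * e * e + K + m * e * K , (begin
    (1 + m * e) * (1 + m * e) ^ s                              ≡⟨ cong ((1 + m * e) *_) eq ⟩
    (1 + m * e) * (1 + s * (m * e) + m * m * K)                ≡⟨ expand m e s K ⟩
    1 + suc s * (m * e) + m * m * (s * e * e + K + m * e * K)  ∎)
  where
  open ≡-Reasoning
  expand : ∀ m e s K → (1 + m * e) * (1 + s * (m * e) + m * m * K)
                       ≡ 1 + (1 + s) * (m * e) + m * m * (s * e * e + K + m * e * K)
  expand = solve-∀

[1+p*m*u]^p≡1+p*[p*m]*_ : ∀ p m u → ∃[ v ] (1 + p * m * u) ^ p ≡ 1 + p * (p * m) * v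
[1+p*m*u]^p≡1+p*[p*m]*_ p m u =
  let K , eq = [1+m*e]^s≡1+s*m*e+m*m*_ (p * m) u p
  in u + m * K , trans eq (rearrange p m u K)
  where
  rearrange : ∀ p m u K → 1 + p * (p * m * u) + p * m * (p * m) * K ≡ 1 + p * (p * m) * (u + m * K)
  rearrange = solve-∀

7^k≡1+2*_ : ∀ k → ∃[ e ] 7 ^ k ≡ 1 + 2 * e
7^k≡1+2*_ k =
  let K , eq = [1+m*e]^s≡1+s*m*e+m*m*_ 2 3 k
  in 3 * k + 2 * K , trans eq (rearrange k K)
  where
  rearrange : ∀ k K → 1 + k * (2 * 3) + 2 * 2 * K ≡ 1 + 2 * (3 * k + 2 * K)
  rearrange = solve-∀

8^[1+2*e]≡2+6*_ : ∀ e → ∃[ s ] 8 ^ (1 + 2 * e) ≡ 2 + 6 * s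
8^[1+2*e]≡2+6*_ e =
  let K , eq = [1+m*e]^s≡1+s*m*e+m*m*_ 3 21 e
  in 1 + 84 * e + 12 * K , (begin
    8 * 8 ^ (2 * e)                     ≡⟨ cong (8 *_) (^-*-assoc 8 2 e) ⟨
    8 * (1 + 3 * 21) ^ e                ≡⟨ cong (8 *_) eq ⟩
    8 * (1 + e * (3 * 21) + 3 * 3 * K)  ≡⟨ rearrange e K ⟩
    2 + 6 * (1 + 84 * e + 12 * K)       ∎)
  where
  open ≡-Reasoning
  rearrange : ∀ e K → 8 * (1 + e * (3 * 21) + 3 * 3 * K) ≡ 2 + 6 * (1 + 84 * e + 12 * K)
  rearrange = solve-∀

8^7^k≡1+7^[1+k]*_ : ∀ k → ∃[ t ] 8 ^ 7 ^ k ≡ 1 + 7 ^ suc k * t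
8^7^k≡1+7^[1+k]*_ zero    = 1 , refl
8^7^k≡1+7^[1+k]*_ (suc k) =
  let t , 8^7^k≡ = 8^7^k≡1+7^[1+k]*_ k
      v , lifted = [1+p*m*u]^p≡1+p*[p*m]*_ 7 (7 ^ k) t
  in v , (begin
    8 ^ (7 * 7 ^ k)          ≡⟨ cong (8 ^_) (*-comm 7 (7 ^ k)) ⟩
    8 ^ (7 ^ k * 7)          ≡⟨ ^-*-assoc 8 (7 ^ k) 7 ⟨
    (8 ^ 7 ^ k) ^ 7          ≡⟨ cong (_^ 7) 8^7^k≡ ⟩
    (1 + 7 * 7 ^ k * t) ^ 7  ≡⟨ lifted ⟩
    1 + 7 * (7 * 7 ^ k) * v  ∎)
  where open ≡-Reasoning

8^7^k≡2+6s∧7^[1+k]∣1+6s : ∀ k → ∃[ s ] ∃[ t ] 8 ^ 7 ^ k ≡ 2 + 6 * s × 1 + 6 * s ≡ 7 ^ k * (7 * t)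
8^7^k≡2+6s∧7^[1+k]∣1+6s k =
  let e , 7^k≡      = 7^k≡1+2*_ k
      s , 8^[1+2e]≡ = 8^[1+2*e]≡2+6*_ e
      t , 8^7^k≡    = 8^7^k≡1+7^[1+k]*_ k
      n≡ = trans (cong (8 ^_) 7^k≡) 8^[1+2e]≡
  in s , t , n≡ , (begin
    1 + 6 * s        ≡⟨ suc-injective (trans (sym n≡) 8^7^k≡) ⟩
    7 * 7 ^ k * t    ≡⟨ cong (_* t) (*-comm 7 (7 ^ k)) ⟩
    7 ^ k * 7 * t    ≡⟨ *-assoc (7 ^ k) 7 t ⟩
    7 ^ k * (7 * t)  ∎)
  where open ≡-Reasoning

x^[r+6s]≡x^r*[1+s*m*e+m*m*_] : ∀ x m {e} r s → x ^ 6 ≡ 1 + m * e →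
                                ∃[ K ] x ^ (r + 6 * s) ≡ x ^ r * (1 + s * (m * e) + m * m * K)
x^[r+6s]≡x^r*[1+s*m*e+m*m*_] x m {e} r s x⁶≡ =
  let K , eq = [1+m*e]^s≡1+s*m*e+m*m*_ m e s
  in K , (begin
    x ^ (r + 6 * s)                        ≡⟨ ^-distribˡ-+-* x r (6 * s) ⟩
    x ^ r * x ^ (6 * s)                    ≡⟨ cong (x ^ r *_) (^-*-assoc x 6 s) ⟨
    x ^ r * (x ^ 6) ^ s                    ≡⟨ cong (λ y → x ^ r * y ^ s) x⁶≡ ⟩
    x ^ r * (1 + m * e) ^ s                ≡⟨ cong (x ^ r *_) eq ⟩
    x ^ r * (1 + s * (m * e) + m * m * K)  ∎)
  where open ≡-Reasoning

-- For n = 2 + 6s, 3 M s = n² − n + 1.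
M : ℕ → ℕ
M s = 1 + 6 * s + 12 * (s * s)

-- The ring solver handles neither ℕ's _^_ nor defined functions, so its identities spell out
-- powers as products and inline M.

-- n⁶ − 1 = (n − 1)(n² + n + 1)(n + 1)(n² − n + 1)
[2+6s]^6≡1+3M*_ : ∀ s →
  let n = 2 + 6 * s
      M = 1 + 6 * s + 12 * (s * s)
  in n * (n * (n * (n * (n * (n * 1))))) ≡ 1 + 3 * M * ((1 + 6 * s) * (n * n + n + 1) * (n + 1))
[2+6s]^6≡1+3M*_ = solve-∀

-- w⁶ − 1 = (w + 1)(w² − w + 1)(w − 1)(w² + w + 1), and w² + w + 1 = n² − n + 1 for w = n − 1
[1+6s]^6≡1+3M*_ : ∀ s →
  let w = 1 + 6 * s
      M = 1 + 6 * s + 12 * (s * s)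
  in w * (w * (w * (w * (w * (w * 1))))) ≡ 1 + 3 * M * ((w + 1) * (1 + 6 * s + 36 * (s * s)) * (6 * s))
[1+6s]^6≡1+3M*_ = solve-∀

-- The expansions of n^n = n²(n⁶)^s and w^w = w(w⁶)^s to first order agree modulo 3M².
first-order-terms-agree : ∀ s K₁ K₂ →
  let n = 2 + 6 * s
      w = 1 + 6 * s
      M = 1 + 6 * s + 12 * (s * s)
      P = 1 + 78 * s + 1044 * (s * s) + 3888 * (s * s * s) + 5832 * (s * s * s * s) + 3888 * (s * s * s * s * s)
  in n * (n * 1) * (1 + s * (3 * M * (w * (n * n + n + 1) * (n + 1))) + 3 * M * (3 * M) * K₁) + 3 * M * M * (3 * w * K₂)
     ≡ w * 1 * (1 + s * (3 * M * ((w + 1) * (1 + 6 * s + 36 * (s * s)) * (6 * s))) + 3 * M * (3 * M) * K₂)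
       + 3 * M * M * (P + 3 * (n * n) * K₁)
first-order-terms-agree = solve-∀

3M²∣[2+6s]^[2+6s]∸[1+6s]^[1+6s] : ∀ s → 3 * M s * M s ∣ (2 + 6 * s) ^ (2 + 6 * s) ∸ (1 + 6 * s) ^ (1 + 6 * s)
3M²∣[2+6s]^[2+6s]∸[1+6s]^[1+6s] s =
  let K₁ , nⁿ≡ = x^[r+6s]≡x^r*[1+s*m*e+m*m*_] (2 + 6 * s) (3 * M s) 2 s ([2+6s]^6≡1+3M*_ s)
      K₂ , wʷ≡ = x^[r+6s]≡x^r*[1+s*m*e+m*m*_] (1 + 6 * s) (3 * M s) 1 s ([1+6s]^6≡1+3M*_ s)
  in +*≡+*⇒∣∸ ((2 + 6 * s) ^ (2 + 6 * s)) ((1 + 6 * s) ^ (1 + 6 * s))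
       (trans (cong₂ _+_ nⁿ≡ refl)
       (trans (first-order-terms-agree s K₁ K₂)
              (cong₂ _+_ (sym wʷ≡) refl)))

rad[abc]*7^k*n<6b : ∀ k s t J → 1 + 6 * s ≡ 7 ^ k * (7 * t) → 2 + 6 * s ∣ᵣ 2 →
  let n = 2 + 6 * s
      w = 1 + 6 * s
      b = n ^ n ∸ w ^ w
  in b ≡ J * (3 * M s * M s) → rad (w ^ w * b * n ^ n) * (7 ^ k * n) < 6 * b
rad[abc]*7^k*n<6b k s zero J w≡ _ _ = contradiction (trans w≡ (*-zeroʳ (7 ^ k))) λ ()
rad[abc]*7^k*n<6b k s t zero w≡ _ b≡0 = contradiction b≡0 (>⇒≢ (m<n⇒0<n∸m (^-self-< (6 * s))))
rad[abc]*7^k*n<6b k s t@(suc _) J@(suc _) w≡ n∣ᵣ2 b≡J*3M² = begin-strict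
  rad (a * b * c) * (7 ^ k * n)              ≤⟨ *-monoˡ-≤ (7 ^ k * n) (∣⇒≤ (rad-∣ abc∣ᵣX)) ⟩
  7 * t * (M s * (3 * J)) * 2 * (7 ^ k * n)  ≡⟨ rearrange (7 ^ k) t (M s) J n ⟩
  6 * (M s * J) * (7 ^ k * (7 * t) * n)      ≡⟨ cong (λ v → 6 * (M s * J) * (v * n)) w≡ ⟨
  6 * (M s * J) * (w * n)                    <⟨ m<m+n _ z<s ⟩
  6 * (M s * J) * (w * n) + 6 * (M s * J)    ≡⟨ 3M≡wn+1 s J ⟩
  6 * (J * (3 * M s * M s))                  ≡⟨ cong (6 *_) b≡J*3M² ⟨
  6 * b                                      ∎
  where
  open ≤-Reasoning
  regroup : ∀ J m → J * (3 * m * m) ≡ m * (m * (3 * J))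
  regroup = solve-∀
  rearrange : ∀ x t m J n → 7 * t * (m * (3 * J)) * 2 * (x * n) ≡ 6 * (m * J) * (x * (7 * t) * n)
  rearrange = solve-∀
  3M≡wn+1 : ∀ s J →
    let M = 1 + 6 * s + 12 * (s * s)
    in 6 * (M * J) * ((1 + 6 * s) * (2 + 6 * s)) + 6 * (M * J) ≡ 6 * (J * (3 * M * M))
  3M≡wn+1 = solve-∀
  n w a b c : ℕ
  n = 2 + 6 * s
  w = 1 + 6 * s
  a = w ^ w
  c = n ^ n
  b = c ∸ a
  a∣ᵣ7t : a ∣ᵣ 7 * t
  a∣ᵣ7t = ∣ᵣ-trans (^-∣ᵣ w w)
            (subst (_∣ᵣ 7 * t) (sym w≡) (∣ᵣ-trans (*-pres-∣ᵣ (^-∣ᵣ 7 k) ∣ᵣ-refl) (m*[m*n]∣ᵣm*n 7 t)))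
  b∣ᵣM*3J : b ∣ᵣ M s * (3 * J)
  b∣ᵣM*3J = subst (_∣ᵣ M s * (3 * J)) (sym (trans b≡J*3M² (regroup J (M s)))) (m*[m*n]∣ᵣm*n (M s) (3 * J))
  abc∣ᵣX : a * b * c ∣ᵣ 7 * t * (M s * (3 * J)) * 2
  abc∣ᵣX = *-pres-∣ᵣ (*-pres-∣ᵣ a∣ᵣ7t b∣ᵣM*3J) (∣ᵣ-trans (^-∣ᵣ n n) n∣ᵣ2)

abc-triple : ∀ k n s t → n ≡ 2 + 6 * s → 1 + 6 * s ≡ 7 ^ k * (7 * t) → n ∣ᵣ 2 →
    let a = (n ∸ 1) ^ (n ∸ 1)
        c = n ^ n
        b = c ∸ a
    in Coprime a b × Coprime b c × Coprime a c × a + b ≡ c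
       × rad (a * b * c) * (7 ^ k * n) < 6 * b
       × rad (a * b * c) * (7 ^ k * n) < 6 * c
abc-triple k _ s t refl w≡ n∣ᵣ2 =
  coprime-∸ʳ a≤c a⊥c , coprime-∸ˡ a≤c a⊥c , a⊥c , m+[n∸m]≡n a≤c ,
  rad-bound , <-≤-trans rad-bound (*-monoʳ-≤ 6 (m∸n≤m c a))
  where
  n w a c : ℕ
  n = 2 + 6 * s
  w = 1 + 6 * s
  a = w ^ w
  c = n ^ n
  a≤c : a ≤ c
  a≤c = <⇒≤ (^-self-< (6 * s))
  a⊥c : Coprime a c
  a⊥c = coprime-^ w n (coprime-suc w)
  3M²∣c∸a : 3 * M s * M s ∣ c ∸ a
  3M²∣c∸a = 3M²∣[2+6s]^[2+6s]∸[1+6s]^[1+6s] s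
  rad-bound : rad (a * (c ∸ a) * c) * (7 ^ k * n) < 6 * (c ∸ a)
  rad-bound = rad[abc]*7^k*n<6b k s t (quotient 3M²∣c∸a) w≡ n∣ᵣ2 (m∣n⇒n≡quotient*m 3M²∣c∸a)

proposition4p8 : (k : ℕ) → 1 ≤ k →
    let n = 8 ^ (7 ^ k)
        a = (n ∸ 1) ^ (n ∸ 1)
        c = n ^ n
        b = c ∸ a
    in Coprime a b × Coprime b c × Coprime a c × a + b ≡ c
       × rad (a * b * c) * (7 ^ k * n) < 6 * b
       × rad (a * b * c) * (7 ^ k * n) < 6 * c
proposition4p8 k _ =
  let s , t , n≡2+6s , w≡7^k*7t = 8^7^k≡2+6s∧7^[1+k]∣1+6s k
  in abc-triple k (8 ^ 7 ^ k) s t n≡2+6s w≡7^k*7t (∣ᵣ-trans (^-∣ᵣ 8 (7 ^ k)) (^-∣ᵣ 2 3))
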